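{- Let $G=(V,E)$ be a simple undirected graph with $|V|=n\ge2$, let $\beta=\lceil 2\lg n\rceil-1$, and let $l:E\to\{0,1\}^{\beta}$ be a fixed labelling of the edges by bit strings (encoding integers in $\{1,\dots,n(n-1)/2\}$). Let $c:\{1,\dots,\beta\}\times E\to\{0,1\}$ be an edge classifier, and for $i\in\{1,\dots,\beta\}$ let $L_c(i)=\{e\in E\mid c(i,e)=1\}$. For $S\subseteq V$ define the $\beta$-bit string $$H_{c,i}(S)=\bigoplus_{v\in S}\ \bigoplus_{e\in\delta_G(v)\cap L_c(i)} l(e),$$ where $\oplus$ is bitwise XOR and $\delta_G(v)$ is the set of edges incident to $v$. Let $S\subseteq V$ be such that the set $E[S,V\setminus S]$ of edges with exactly one endpoint in $S$ is nonempty. Then with probability at least $1/9$ there exist an integer $j\in\{1,\dots,\beta\}$ and an edge $e\in E[S,V\setminus S]$ such that $H_{c,j}(S)=l(e)$.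
   Context: An edge classifier is a random function $c:\{1,\dots,\lceil 2\lg n\rceil-1\}\times E\to\{0,1\}$ such that the values $c(i,e)$ are mutually independent over all pairs $(i,e)$ and $\Pr[c(i,e)=1]=2^{ -i}$. -}

module Defs where

open import Data.Nat using (ℕ; zero; suc; _+_; _*_; _∸_; _^_; _≤_)
open import Data.Nat.Logarithm using (⌈log₂_⌉)
open import Data.Bool using (Bool; true; false; if_then_else_; _xor_; _∧_; _∨_)
open import Data.Fin using (Fin; toℕ) renaming (zero to fzero; suc to fsuc)
open import Data.Fin.Properties using (any?)
open import Data.Fin.Subset using (Subset; _∈_; _∉_)
open import Data.Fin.Subset.Properties using (_∈?_)
open import Data.Vec using (Vec; []; _∷_; replicate; zipWith; foldl)
open import Data.Vec.Properties using (≡-dec)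
open import Data.Product using (Σ; _×_; _,_; proj₁; proj₂)
open import Data.Product.Properties using () renaming (≡-dec to ×-≡-dec)
open import Data.Sum using (_⊎_)
open import Relation.Nullary using (Dec; does; ¬_)
open import Relation.Nullary.Decidable using (⌊_⌋; _×-dec_; _⊎-dec_; ¬?)
open import Relation.Binary.PropositionalEquality using (_≡_)
import Data.Bool.Properties as BP
import Data.Fin as F

record SimpleGraph (n : ℕ) : Set where
  field
    m      : ℕ
    ends   : Fin m → Fin n × Fin n
    noLoop : ∀ e → ¬ (proj₁ (ends e) ≡ proj₂ (ends e))
    noMulti : ∀ e e' →
      (ends e ≡ ends e' ⊎ (proj₁ (ends e) ≡ proj₂ (ends e') × proj₂ (ends e) ≡ proj₁ (ends e'))) →
      e ≡ e'

open SimpleGraph public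

-- β = ⌈2 lg n⌉ - 1 ; note 2 lg n = lg (n²)
β : ℕ → ℕ
β n = ⌈log₂ (n * n) ⌉ ∸ 1

BitString : ℕ → Set
BitString k = Vec Bool k

zeroBits : ∀ {k} → BitString k
zeroBits = replicate _ false

_⊕_ : ∀ {k} → BitString k → BitString k → BitString k
_⊕_ = zipWith _xor_

-- integer encoded by a bit string, most significant bit first
bitsVal : ∀ {k} → BitString k → ℕ
bitsVal = foldl _ (λ acc b → 2 * acc + (if b then 1 else 0)) 0

bigXor : ∀ {b} (k : ℕ) → (Fin k → BitString b) → BitString b
bigXor zero    f = zeroBits
bigXor (suc k) f = f fzero ⊕ bigXor k (λ i → f (fsuc i))

-- Edge classifiers: c (i, e) for i ∈ {1..β}, represented by Fin β
-- (index i : Fin β stands for the integer toℕ i + 1).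

Classifier : (b m : ℕ) → Set
Classifier b m = Fin b → Fin m → Bool

incident : ∀ {n} (G : SimpleGraph n) → Fin n → Fin (m G) → Bool
incident G v e = ⌊ proj₁ (ends G e) F.≟ v ⌋ ∨ ⌊ proj₂ (ends G e) F.≟ v ⌋

H : ∀ {n b} (G : SimpleGraph n) (l : Fin (m G) → BitString b) →
    Classifier b (m G) → Fin b → Subset n → BitString b
H {n} G l c i S =
  bigXor n (λ v → if ⌊ v ∈? S ⌋
                  then bigXor (m G) (λ e → if incident G v e ∧ c i e then l e else zeroBits)
                  else zeroBits)

InCut : ∀ {n} (G : SimpleGraph n) → Subset n → Fin (m G) → Set
InCut G S e = (proj₁ (ends G e) ∈ S × proj₂ (ends G e) ∉ S)
            ⊎ (proj₁ (ends G e) ∉ S × proj₂ (ends G e) ∈ S)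

inCut? : ∀ {n} (G : SimpleGraph n) (S : Subset n) (e : Fin (m G)) → Dec (InCut G S e)
inCut? G S e = ((_ ∈? S) ×-dec ¬? (_ ∈? S)) ⊎-dec (¬? (_ ∈? S) ×-dec (_ ∈? S))

Event : ∀ {n b} (G : SimpleGraph n) (l : Fin (m G) → BitString b) →
        Subset n → Classifier b (m G) → Set
Event {b = b} G l S c = Σ (Fin b) λ j → Σ (Fin (m G)) λ e → InCut G S e × H G l c j S ≡ l e

event? : ∀ {n b} (G : SimpleGraph n) (l : Fin (m G) → BitString b) →
         (S : Subset n) (c : Classifier b (m G)) → Dec (Event G l S c)
event? G l S c = any? λ j → any? λ e → inCut? G S e ×-dec ≡-dec BP._≟_ (H G l c j S) (l e)

-- The law: c(i,e) independent, Pr[c(i,e)=1] = 2^{-(toℕ i + 1)}.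
-- We work with the common denominator D = ∏_{i,e} 2^{toℕ i + 1}; the
-- probability of a classifier c is weight c / D where
-- weight c = ∏_{i,e} (1 if c(i,e)=1 else 2^{toℕ i+1} - 1).

prodFin : (k : ℕ) → (Fin k → ℕ) → ℕ
prodFin zero    f = 1
prodFin (suc k) f = f fzero * prodFin k (λ i → f (fsuc i))

sumFun : ∀ {A : Set} (k : ℕ) → ((A → ℕ) → ℕ) → ((Fin k → A) → ℕ) → ℕ
sumFun zero    sumA g = g (λ ())
sumFun (suc k) sumA g = sumA (λ a → sumFun k sumA (λ f → g (λ { fzero → a ; (fsuc i) → f i })))

sumBool : (Bool → ℕ) → ℕ
sumBool g = g true + g false

sumClassifiers : (b m : ℕ) → (Classifier b m → ℕ) → ℕ
sumClassifiers b m = sumFun b (sumFun m sumBool)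

weight : ∀ {b m} → Classifier b m → ℕ
weight {b} {m} c = prodFin b λ i → prodFin m λ e →
  if c i e then 1 else 2 ^ suc (toℕ i) ∸ 1

denom : (b m : ℕ) → ℕ
denom b m = prodFin b λ i → prodFin m λ e → 2 ^ suc (toℕ i)

-- numerator of Pr[P], i.e. Pr[P] = probNum P? / denom b m
probNum : ∀ {b m} {P : Classifier b m → Set} → ((c : Classifier b m) → Dec (P c)) → ℕ
probNum {b} {m} P? = sumClassifiers b m λ c → if does (P? c) then weight c else 0

{-# OPTIONS --safe #-}
module Submission where

-- Let K ≥ 1 be the number of cut edges and j the level with 2^j ≤ K < 2^(j+1) (j = 1 if K = 1);
-- j ≤ β because K < n².  H_{c,j}(S) is the XOR of the labels of the cut edges selected at level j,
-- since an edge with both endpoints in S is XORed twice; so the event holds as soon as exactly one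
-- cut edge is selected at level j.  By independence of the levels this has probability
-- K p (1 - p)^(K - 1) with p = 1/(q + 1), q = 2^j - 1.  As q < K ≤ 2(q + 1), this is at least 1/9
-- once (1 + 1/q)^(q + 1) ≤ 3, which holds for q = 7 by computation and for larger q = 2^j - 1
-- because (1 + 1/q)^(q + 1) decreases along q ↦ 2q + 1; the levels j = 1, 2 are checked directly.

open import Defs
open import Algebra.Bundles using (CommutativeMonoid)
import Algebra.Properties.CommutativeMonoid.Sum as MonoidSum
open import Data.Bool using (Bool; true; false; if_then_else_; _∧_; _∨_; _xor_; not)
open import Data.Bool.Properties
  using (xor-assoc; xor-comm; xor-identityˡ; xor-identityʳ; xor-same; ∧-comm; ∧-distribʳ-xor; ∧-conicalʳ;
         T-≡)
open import Data.Empty using (⊥-elim)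
open import Data.Fin using (Fin; zero; suc; toℕ; fromℕ<; _≟_; combine; punchOut)
open import Data.Fin.Properties
  using (toℕ-fromℕ<; combine-injective; punchOut-injective; injective⇒≤)
  renaming (suc-injective to Fin-suc-injective)
open import Data.Fin.Subset using (Subset)
open import Data.Fin.Subset.Properties using (_∈?_)
open import Data.Nat
  using (ℕ; zero; suc; _+_; _*_; _∸_; _^_; _/_; _≤_; _<_; _⊔_; _≡ᵇ_; z≤n; s≤s; NonZero; ⌈_/2⌉)
open import Data.Nat.Logarithm using (⌈log₂_⌉; ⌈log₂⌉-mono-≤; ⌈log₂⌈n/2⌉⌉≡⌈log₂n⌉∸1)
open import Data.Nat.Properties hiding (_≟_)
open import Data.Nat.Tactic.RingSolver using (solve-∀)
open import Algebra.Properties.CommutativeSemigroup *-commutativeSemigroup using (interchange; x∙yz≈y∙xz)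
open import Data.Product using (Σ; ∃-syntax; _×_; _,_; proj₁; proj₂)
open import Data.Sum using (inj₁)
open import Data.Vec.Functional using (_∷_)
open import Data.Vec.Properties
  using (zipWith-assoc; zipWith-comm; zipWith-identityˡ; zipWith-identityʳ; zipWith-inverseˡ; map-id)
open import Function using (_∘_; id; Equivalence)
open import Level using (0ℓ)
open import Relation.Binary.PropositionalEquality
open import Relation.Binary.PropositionalEquality.Algebra using (isMagma)
open import Relation.Nullary using (Dec; yes; no; does; contradiction)
open import Relation.Nullary.Decidable using (⌊_⌋; _×-dec_; _⊎-dec_; ¬?; toWitness; fromWitness)

mersenne : ℕ → ℕ
mersenne zero    = 0
mersenne (suc t) = mersenne t + suc (mersenne t)

suc-mersenne : ∀ t → suc (mersenne t) ≡ 2 ^ t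
suc-mersenne zero    = refl
suc-mersenne (suc t) = begin
  suc (mersenne t) + suc (mersenne t) ≡⟨ cong (λ x → x + x) (suc-mersenne t) ⟩
  2 ^ t + 2 ^ t                       ≡⟨ cong (2 ^ t +_) (+-identityʳ (2 ^ t)) ⟨
  2 ^ suc t                           ∎
  where open ≡-Reasoning

mersenne≡2^t∸1 : ∀ t → mersenne t ≡ 2 ^ t ∸ 1
mersenne≡2^t∸1 t = cong (_∸ 1) (suc-mersenne t)

mersenne-nonZero : ∀ t → NonZero (mersenne (suc t))
mersenne-nonZero t = subst NonZero (sym (+-suc (mersenne t) (mersenne t))) _

^-distrib-* : ∀ x y k → (x * y) ^ k ≡ x ^ k * y ^ k
^-distrib-* x y zero    = refl
^-distrib-* x y (suc k) = begin
  x * y * (x * y) ^ k       ≡⟨ cong (x * y *_) (^-distrib-* x y k) ⟩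
  x * y * (x ^ k * y ^ k)   ≡⟨ interchange x y (x ^ k) (y ^ k) ⟩
  x * x ^ k * (y * y ^ k)   ∎
  where open ≡-Reasoning

^-*-square : ∀ x k → x ^ (k + k) ≡ (x * x) ^ k
^-*-square x k = trans (^-distribˡ-+-* x k k) (sym (^-distrib-* x x k))

binade : ∀ K → 1 ≤ K → ∃[ t ] 2 ^ t ≤ K × K < 2 ^ suc t
binade 0             ()
binade 1             _ = 0 , ≤-refl , ≤ᵇ⇒≤ _ _ _
binade (suc (suc k)) _ with binade (suc k) (s≤s z≤n)
... | t , 2^t≤K , K<2^[t+1] with suc (suc k) <? 2 ^ suc t
...   | yes K+1<2^[t+1] = t , m≤n⇒m≤1+n 2^t≤K , K+1<2^[t+1]
...   | no  K+1≮2^[t+1] =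
  suc t , ≤-reflexive 2^[t+1]≡K+1 , subst (_< 2 ^ suc (suc t)) 2^[t+1]≡K+1 2^[t+1]<2^[t+2]
  where
  2^[t+1]≡K+1 : 2 ^ suc t ≡ suc (suc k)
  2^[t+1]≡K+1 = ≤-antisym (≮⇒≥ K+1≮2^[t+1]) K<2^[t+1]
  2^[t+1]<2^[t+2] : 2 ^ suc t < 2 ^ suc (suc t)
  2^[t+1]<2^[t+2] = ^-monoʳ-< 2 (s≤s (s≤s z≤n)) (n<1+n (suc t))

2^<⇒<⌈log₂⌉ : ∀ t {x} → 2 ^ t < x → t < ⌈log₂ x ⌉
2^<⇒<⌈log₂⌉ zero    {x} 1<x       = ⌈log₂⌉-mono-≤ {2} 1<x
2^<⇒<⌈log₂⌉ (suc t) {x} 2^[t+1]<x =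
  <-pred⇒suc< (subst (t <_) (⌈log₂⌈n/2⌉⌉≡⌈log₂n⌉∸1 x) (2^<⇒<⌈log₂⌉ t 2^t<⌈x/2⌉))
  where
  <-pred⇒suc< : ∀ {m n} → m < n ∸ 1 → suc m < n
  <-pred⇒suc< {n = suc n} m<n = s≤s m<n
  2^t<⌈x/2⌉ : 2 ^ t < ⌈ x /2⌉
  2^t<⌈x/2⌉ = begin-strict
    2 ^ t                       <⟨ n<1+n (2 ^ t) ⟩
    suc (2 ^ t)                 ≡⟨ cong suc (n≡⌊n+n/2⌋ (2 ^ t)) ⟩
    ⌈ suc (2 ^ t + 2 ^ t) /2⌉   ≤⟨ ⌈n/2⌉-mono 2^t+2^t<x ⟩
    ⌈ x /2⌉                     ∎
    where
    open ≤-Reasoning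
    2^t+2^t<x : 2 ^ t + 2 ^ t < x
    2^t+2^t<x = subst (_< x) (cong (2 ^ t +_) (+-identityʳ (2 ^ t))) 2^[t+1]<x

-- The bound (1 + 1/q)^(q+1) ≤ 3

-- (1 + 1/q)^(q+1) decreases along q ↦ 2q + 1.
ratio-antitone : ∀ q → let N = suc q in
  q ^ N * (N + N) ^ (N + N) ≤ (q + N) ^ (N + N) * N ^ N
ratio-antitone q = begin
  q ^ N * (N + N) ^ (N + N)         ≡⟨ cong (q ^ N *_) (^-*-square (N + N) N) ⟩
  q ^ N * ((N + N) * (N + N)) ^ N   ≡⟨ ^-distrib-* q _ N ⟨
  (q * ((N + N) * (N + N))) ^ N     ≤⟨ ^-monoˡ-≤ N base ⟩
  ((q + N) * (q + N) * N) ^ N       ≡⟨ ^-distrib-* ((q + N) * (q + N)) N N ⟩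
  ((q + N) * (q + N)) ^ N * N ^ N   ≡⟨ cong (_* N ^ N) (^-*-square (q + N) N) ⟨
  (q + N) ^ (N + N) * N ^ N         ∎
  where
  open ≤-Reasoning
  N = suc q
  -- (2q + 1)² = 4 q N + 1
  base : q * ((N + N) * (N + N)) ≤ (q + N) * (q + N) * N
  base = ≤-trans (m≤m+n _ N) (≤-reflexive (identity q))
    where
    identity : ∀ q → q * ((suc q + suc q) * (suc q + suc q)) + suc q
                   ≡ (q + suc q) * (q + suc q) * suc q
    identity = solve-∀

RatioBounded : ℕ → Set
RatioBounded q = suc q ^ suc q ≤ 3 * q ^ suc q

ratioBounded-double : ∀ q → RatioBounded q → RatioBounded (q + suc q)
ratioBounded-double q bounded = *-cancelʳ-≤ _ _ (N ^ N) {{m^n≢0 N N}} (begin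
  (N + N) ^ (N + N) * N ^ N         ≤⟨ *-monoʳ-≤ ((N + N) ^ (N + N)) bounded ⟩
  (N + N) ^ (N + N) * (3 * q ^ N)   ≡⟨ rearrange ((N + N) ^ (N + N)) (q ^ N) ⟩
  3 * (q ^ N * (N + N) ^ (N + N))   ≤⟨ *-monoʳ-≤ 3 (ratio-antitone q) ⟩
  3 * ((q + N) ^ (N + N) * N ^ N)   ≡⟨ *-assoc 3 ((q + N) ^ (N + N)) (N ^ N) ⟨
  3 * (q + N) ^ (N + N) * N ^ N     ∎)
  where
  open ≤-Reasoning
  N = suc q
  rearrange : ∀ a b → a * (3 * b) ≡ 3 * (b * a)
  rearrange = solve-∀

ratioBounded-mersenne : ∀ t → RatioBounded (mersenne (3 + t))
ratioBounded-mersenne zero    = ≤ᵇ⇒≤ _ _ _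
ratioBounded-mersenne (suc t) = ratioBounded-double (mersenne (3 + t)) (ratioBounded-mersenne t)

ratioBounded-square : ∀ q → RatioBounded q → suc q ^ (suc q + suc q) ≤ 9 * q ^ (suc q + suc q)
ratioBounded-square q bounded = begin
  N ^ (N + N)             ≡⟨ ^-distribˡ-+-* N N N ⟩
  N ^ N * N ^ N           ≤⟨ *-mono-≤ bounded bounded ⟩
  3 * q ^ N * (3 * q ^ N) ≡⟨ rearrange (q ^ N) ⟩
  9 * (q ^ N * q ^ N)     ≡⟨ cong (9 *_) (^-distribˡ-+-* q N N) ⟨
  9 * q ^ (N + N)         ∎
  where
  open ≤-Reasoning
  N = suc q
  rearrange : ∀ a → 3 * a * (3 * a) ≡ 9 * (a * a)
  rearrange = solve-∀

ratioBounded⇒[1+q]^k≤9*q^k : ∀ q {k} → RatioBounded q → k ≤ suc q + suc q → suc q ^ k ≤ 9 * q ^ k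
ratioBounded⇒[1+q]^k≤9*q^k q {k} bounded k≤N+N = *-cancelʳ-≤ _ _ (N ^ d) {{m^n≢0 N d}} (begin
  N ^ k * N ^ d           ≡⟨ ^-distribˡ-+-* N k d ⟨
  N ^ (k + d)             ≡⟨ cong (N ^_) k+d≡N+N ⟩
  N ^ (N + N)             ≤⟨ ratioBounded-square q bounded ⟩
  9 * q ^ (N + N)         ≡⟨ cong (λ x → 9 * q ^ x) k+d≡N+N ⟨
  9 * q ^ (k + d)         ≡⟨ cong (9 *_) (^-distribˡ-+-* q k d) ⟩
  9 * (q ^ k * q ^ d)     ≡⟨ *-assoc 9 (q ^ k) (q ^ d) ⟨
  9 * q ^ k * q ^ d       ≤⟨ *-monoʳ-≤ (9 * q ^ k) (^-monoˡ-≤ d (n≤1+n q)) ⟩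
  9 * q ^ k * N ^ d       ∎)
  where
  open ≤-Reasoning
  N = suc q
  d = N + N ∸ k
  k+d≡N+N : k + d ≡ N + N
  k+d≡N+N = m+[n∸m]≡n k≤N+N

-- K p (1 - p)^(K - 1) ≥ 1/9 for p = 1/(q + 1), cleared of denominators.
ExactlyOneLikely : ℕ → ℕ → Set
ExactlyOneLikely q K = q * suc q ^ K ≤ 9 * (K * q ^ K)

ratioBounded⇒exactlyOneLikely : ∀ q {K} → RatioBounded q → suc q ≤ K → K ≤ suc q + suc q →
                                ExactlyOneLikely q K
ratioBounded⇒exactlyOneLikely q {K} bounded N≤K K≤N+N = begin
  q * suc q ^ K      ≤⟨ *-mono-≤ (≤-trans (n≤1+n q) N≤K)
                                 (ratioBounded⇒[1+q]^k≤9*q^k q bounded K≤N+N) ⟩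
  K * (9 * q ^ K)    ≡⟨ x∙yz≈y∙xz K 9 (q ^ K) ⟩
  9 * (K * q ^ K)    ∎
  where open ≤-Reasoning

exactlyOneLikely-binade : ∀ s {K} → 2 ^ suc s ≤ K → K < 2 ^ suc (suc s) →
                          ExactlyOneLikely (mersenne (suc s)) K
exactlyOneLikely-binade 0 {0} () _
exactlyOneLikely-binade 0 {1} (s≤s ()) _
exactlyOneLikely-binade 0 {2} _ _ = ≤ᵇ⇒≤ _ _ _
exactlyOneLikely-binade 0 {3} _ _ = ≤ᵇ⇒≤ _ _ _
exactlyOneLikely-binade 0 {suc (suc (suc (suc _)))} _ (s≤s (s≤s (s≤s (s≤s ()))))
exactlyOneLikely-binade 1 {0} () _
exactlyOneLikely-binade 1 {1} (s≤s ()) _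
exactlyOneLikely-binade 1 {2} (s≤s (s≤s ())) _
exactlyOneLikely-binade 1 {3} (s≤s (s≤s (s≤s ()))) _
exactlyOneLikely-binade 1 {4} _ _ = ≤ᵇ⇒≤ _ _ _
exactlyOneLikely-binade 1 {5} _ _ = ≤ᵇ⇒≤ _ _ _
exactlyOneLikely-binade 1 {6} _ _ = ≤ᵇ⇒≤ _ _ _
exactlyOneLikely-binade 1 {7} _ _ = ≤ᵇ⇒≤ _ _ _
exactlyOneLikely-binade 1 {suc (suc (suc (suc (suc (suc (suc (suc _)))))))} _
  (s≤s (s≤s (s≤s (s≤s (s≤s (s≤s (s≤s (s≤s ()))))))))
exactlyOneLikely-binade (suc (suc u)) {K} 2^t≤K K<2^[t+1] =
  ratioBounded⇒exactlyOneLikely (mersenne (3 + u)) (ratioBounded-mersenne u)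
    (subst (_≤ K) (sym (suc-mersenne (3 + u))) 2^t≤K)
    (subst (K ≤_) (sym (suc-mersenne (4 + u))) (<⇒≤ K<2^[t+1]))

exactlyOneLikely-level : ∀ K → 1 ≤ K →
                         ∃[ s ] 2 ^ suc s ≤ K ⊔ 2 × ExactlyOneLikely (mersenne (suc s)) K
exactlyOneLikely-level K 1≤K with binade K 1≤K
... | zero  , _     , s≤s (s≤s z≤n) = 0 , ≤-refl , ≤ᵇ⇒≤ _ _ _
... | suc s , 2^t≤K , K<2^[t+1]     =
  s , ≤-trans 2^t≤K (m≤m⊔n K 2) , exactlyOneLikely-binade s 2^t≤K K<2^[t+1]

-- Index i stands for level i + 1, which selects an edge with probability 1/(oddsAgainst i + 1).
oddsAgainst : ∀ {b} → Fin b → ℕ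
oddsAgainst i = 2 ^ suc (toℕ i) ∸ 1

oddsAgainst-nonZero : ∀ {b} (i : Fin b) → NonZero (oddsAgainst i)
oddsAgainst-nonZero i = subst NonZero (mersenne≡2^t∸1 (suc (toℕ i))) (mersenne-nonZero (toℕ i))

exactlyOneLikely-level<β : ∀ {n K} → 2 ≤ n → 1 ≤ K → K < n * n →
                           ∃[ j ] ExactlyOneLikely (oddsAgainst {β n} j) K
exactlyOneLikely-level<β {n} {K} n≥2 K≥1 K<n*n with exactlyOneLikely-level K K≥1
... | s , 2^[s+1]≤K⊔2 , likely = fromℕ< s<β , subst (λ q → ExactlyOneLikely q K) mersenne≡odds likely
  where
  2<n*n : 2 < n * n
  2<n*n = <-≤-trans (s≤s (s≤s (s≤s z≤n))) (*-mono-≤ n≥2 n≥2)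
  2^[s+1]<n*n : 2 ^ suc s < n * n
  2^[s+1]<n*n = ≤-<-trans 2^[s+1]≤K⊔2 (⊔-pres-<m K<n*n 2<n*n)
  s<β : s < β n
  s<β = ∸-monoˡ-< (2^<⇒<⌈log₂⌉ (suc s) 2^[s+1]<n*n) (s≤s z≤n)
  mersenne≡odds : mersenne (suc s) ≡ oddsAgainst (fromℕ< s<β)
  mersenne≡odds =
    trans (mersenne≡2^t∸1 (suc s)) (cong (λ t → 2 ^ suc t ∸ 1) (sym (toℕ-fromℕ< s<β)))

count : ∀ {k} → (Fin k → Bool) → ℕ
count {zero}  p = 0
count {suc k} p = if p zero then suc (count (p ∘ suc)) else count (p ∘ suc)

count+count-not : ∀ {k} (p : Fin k → Bool) → count p + count (not ∘ p) ≡ k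
count+count-not {zero}  p = refl
count+count-not {suc k} p with p zero
... | true  = cong suc (count+count-not (p ∘ suc))
... | false = trans (+-suc (count (p ∘ suc)) _) (cong suc (count+count-not (p ∘ suc)))

count≤ : ∀ {k} (p : Fin k → Bool) → count p ≤ k
count≤ p = subst (count p ≤_) (count+count-not p) (m≤m+n (count p) _)

count-pos : ∀ {k} (p : Fin k → Bool) i → p i ≡ true → 1 ≤ count p
count-pos p zero    pᵢ rewrite pᵢ = s≤s z≤n
count-pos p (suc i) pᵢ with p zero
... | true  = s≤s z≤n
... | false = count-pos (p ∘ suc) i pᵢ

hits : ∀ {M} → (Fin M → Bool) → (Fin M → Bool) → ℕ
hits r cut = count (λ e → r e ∧ cut e)

-- XOR sums of bit strings

⊕-commutativeMonoid : ℕ → CommutativeMonoid 0ℓ 0ℓ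
⊕-commutativeMonoid k = record
  { Carrier = BitString k
  ; _≈_ = _≡_
  ; _∙_ = _⊕_
  ; ε = zeroBits
  ; isCommutativeMonoid = record
    { isMonoid = record
      { isSemigroup = record { isMagma = isMagma _⊕_ ; assoc = zipWith-assoc xor-assoc }
      ; identity = zipWith-identityˡ xor-identityˡ , zipWith-identityʳ xor-identityʳ
      }
    ; comm = zipWith-comm xor-comm
    }
  }

open module ⊕-Sum {k} = MonoidSum (⊕-commutativeMonoid k)
  using (sum; sum-cong-≗; sum-replicate-zero; ∑-distrib-+; ∑-comm)

⊕-identityˡ : ∀ {b} (x : BitString b) → zeroBits ⊕ x ≡ x
⊕-identityˡ = zipWith-identityˡ xor-identityˡ

⊕-identityʳ : ∀ {b} (x : BitString b) → x ⊕ zeroBits ≡ x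
⊕-identityʳ = zipWith-identityʳ xor-identityʳ

⊕-self : ∀ {b} (x : BitString b) → x ⊕ x ≡ zeroBits
⊕-self x = trans (cong (_⊕ x) (sym (map-id x))) (zipWith-inverseˡ {⁻¹ = id} xor-same x)

bigXor≡sum : ∀ {b} k (f : Fin k → BitString b) → bigXor k f ≡ sum f
bigXor≡sum zero    f = refl
bigXor≡sum (suc k) f = cong (f zero ⊕_) (bigXor≡sum k (f ∘ suc))

infixr 25 _⊙_

_⊙_ : ∀ {b} → Bool → BitString b → BitString b
a ⊙ x = if a then x else zeroBits

⊙-zero : ∀ {b} a → a ⊙ zeroBits {b} ≡ zeroBits
⊙-zero true  = refl
⊙-zero false = refl

⊙-⊙ : ∀ {b} a c (x : BitString b) → a ⊙ c ⊙ x ≡ (a ∧ c) ⊙ x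
⊙-⊙ true  c x = refl
⊙-⊙ false c x = refl

⊙-xor : ∀ {b} a c (x : BitString b) → a ⊙ x ⊕ c ⊙ x ≡ (a xor c) ⊙ x
⊙-xor true  true  x = ⊕-self x
⊙-xor true  false x = ⊕-identityʳ x
⊙-xor false c     x = ⊕-identityˡ (c ⊙ x)

⊙-sum : ∀ {b k} a (f : Fin k → BitString b) → a ⊙ sum f ≡ sum (λ i → a ⊙ f i)
⊙-sum         true  f = refl
⊙-sum {k = k} false f = sym (sum-replicate-zero k)

sum-δ : ∀ {b k} (u : Fin k) (f : Fin k → BitString b) → sum (λ v → ⌊ u ≟ v ⌋ ⊙ f v) ≡ f u
sum-δ {k = suc k} zero f = trans (cong (f zero ⊕_) (sum-replicate-zero k)) (⊕-identityʳ (f zero))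
sum-δ (suc u) f = begin
  zeroBits ⊕ sum (λ v → ⌊ suc u ≟ suc v ⌋ ⊙ f (suc v)) ≡⟨ ⊕-identityˡ _ ⟩
  sum (λ v → ⌊ suc u ≟ suc v ⌋ ⊙ f (suc v))            ≡⟨ sum-cong-≗ δ-suc ⟩
  sum (λ v → ⌊ u ≟ v ⌋ ⊙ f (suc v))                    ≡⟨ sum-δ u (f ∘ suc) ⟩
  f (suc u)                                            ∎
  where
  open ≡-Reasoning
  δ-suc : ∀ v → ⌊ suc u ≟ suc v ⌋ ⊙ f (suc v) ≡ ⌊ u ≟ v ⌋ ⊙ f (suc v)
  δ-suc v with u ≟ v
  ... | yes _ = refl
  ... | no  _ = refl

δ-split : ∀ {n b} {u w : Fin n} → u ≢ w → ∀ v s a (x : BitString b) →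
          s ⊙ ((⌊ u ≟ v ⌋ ∨ ⌊ w ≟ v ⌋) ∧ a) ⊙ x
            ≡ ⌊ u ≟ v ⌋ ⊙ s ⊙ a ⊙ x ⊕ ⌊ w ≟ v ⌋ ⊙ s ⊙ a ⊙ x
δ-split {u = u} {w} u≢w v s a x with u ≟ v | w ≟ v
... | yes u≡v | yes w≡v = ⊥-elim (u≢w (trans u≡v (sym w≡v)))
... | yes _   | no  _   = sym (⊕-identityʳ _)
... | no  _   | yes _   = sym (⊕-identityˡ _)
... | no  _   | no  _   = trans (⊙-zero s) (sym (⊕-identityˡ zeroBits))

sum-select-none : ∀ {b k} (p : Fin k → Bool) (x : Fin k → BitString b) →
                  count p ≡ 0 → sum (λ i → p i ⊙ x i) ≡ zeroBits
sum-select-none {k = zero}  p x _ = refl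
sum-select-none {k = suc k} p x none with p zero
... | true  with () ← none
... | false = trans (⊕-identityˡ _) (sum-select-none (p ∘ suc) (x ∘ suc) none)

sum-select-unique : ∀ {b k} (p : Fin k → Bool) (x : Fin k → BitString b) →
                    count p ≡ 1 → ∃[ i ] p i ≡ true × sum (λ i → p i ⊙ x i) ≡ x i
sum-select-unique {k = suc k} p x one with p zero in p₀
... | true  = zero , p₀ , trans (cong (x zero ⊕_) rest-none) (⊕-identityʳ (x zero))
  where
  rest-none : sum (λ i → p (suc i) ⊙ x (suc i)) ≡ zeroBits
  rest-none = sum-select-none (p ∘ suc) (x ∘ suc) (suc-injective one)
... | false with sum-select-unique (p ∘ suc) (x ∘ suc) one
...   | i , pᵢ , sum≡xᵢ = suc i , pᵢ , trans (⊕-identityˡ _) sum≡xᵢ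

xor-separates : ∀ {n} (S : Subset n) x y →
  ⌊ x ∈? S ⌋ xor ⌊ y ∈? S ⌋
    ≡ ⌊ ((x ∈? S) ×-dec ¬? (y ∈? S)) ⊎-dec (¬? (x ∈? S) ×-dec (y ∈? S)) ⌋
xor-separates S x y with x ∈? S | y ∈? S
... | yes _ | yes _ = refl
... | yes _ | no  _ = refl
... | no  _ | yes _ = refl
... | no  _ | no  _ = refl

cutEdges : ∀ {n} (G : SimpleGraph n) → Subset n → Fin (m G) → Bool
cutEdges G S e = ⌊ inCut? G S e ⌋

module _ {n} (G : SimpleGraph n) (S : Subset n) where

  sum-incident : ∀ e a {b} (x : BitString b) →
    sum (λ v → ⌊ v ∈? S ⌋ ⊙ (incident G v e ∧ a) ⊙ x) ≡ (a ∧ cutEdges G S e) ⊙ x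
  sum-incident e a x = begin
    sum (λ v → ⌊ v ∈? S ⌋ ⊙ (incident G v e ∧ a) ⊙ x)
      ≡⟨ sum-cong-≗ (λ v → δ-split (noLoop G e) v ⌊ v ∈? S ⌋ a x) ⟩
    sum (λ v → ⌊ u ≟ v ⌋ ⊙ y v ⊕ ⌊ w ≟ v ⌋ ⊙ y v)
      ≡⟨ ∑-distrib-+ (λ v → ⌊ u ≟ v ⌋ ⊙ y v) (λ v → ⌊ w ≟ v ⌋ ⊙ y v) ⟩
    sum (λ v → ⌊ u ≟ v ⌋ ⊙ y v) ⊕ sum (λ v → ⌊ w ≟ v ⌋ ⊙ y v)
      ≡⟨ cong₂ _⊕_ (sum-δ u y) (sum-δ w y) ⟩
    ⌊ u ∈? S ⌋ ⊙ a ⊙ x ⊕ ⌊ w ∈? S ⌋ ⊙ a ⊙ x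
      ≡⟨ cong₂ _⊕_ (⊙-⊙ ⌊ u ∈? S ⌋ a x) (⊙-⊙ ⌊ w ∈? S ⌋ a x) ⟩
    (⌊ u ∈? S ⌋ ∧ a) ⊙ x ⊕ (⌊ w ∈? S ⌋ ∧ a) ⊙ x
      ≡⟨ ⊙-xor (⌊ u ∈? S ⌋ ∧ a) (⌊ w ∈? S ⌋ ∧ a) x ⟩
    ((⌊ u ∈? S ⌋ ∧ a) xor (⌊ w ∈? S ⌋ ∧ a)) ⊙ x
      ≡⟨ cong (_⊙ x) (∧-distribʳ-xor a ⌊ u ∈? S ⌋ ⌊ w ∈? S ⌋) ⟨
    ((⌊ u ∈? S ⌋ xor ⌊ w ∈? S ⌋) ∧ a) ⊙ x
      ≡⟨ cong (_⊙ x) (trans (∧-comm _ a) (cong (a ∧_) (xor-separates S u w))) ⟩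
    (a ∧ cutEdges G S e) ⊙ x ∎
    where
    open ≡-Reasoning
    u = proj₁ (ends G e)
    w = proj₂ (ends G e)
    y = λ v → ⌊ v ∈? S ⌋ ⊙ a ⊙ x

  H≡sum-cut : ∀ {b} (l : Fin (m G) → BitString b) c j →
              H G l c j S ≡ sum (λ e → (c j e ∧ cutEdges G S e) ⊙ l e)
  H≡sum-cut l c j = begin
    H G l c j S
      ≡⟨ bigXor≡sum n (λ v → ⌊ v ∈? S ⌋ ⊙ bigXor (m G) (x v)) ⟩
    sum (λ v → ⌊ v ∈? S ⌋ ⊙ bigXor (m G) (x v))
      ≡⟨ sum-cong-≗ (λ v → cong (⌊ v ∈? S ⌋ ⊙_) (bigXor≡sum (m G) (x v))) ⟩
    sum (λ v → ⌊ v ∈? S ⌋ ⊙ sum (x v))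
      ≡⟨ sum-cong-≗ (λ v → ⊙-sum ⌊ v ∈? S ⌋ (x v)) ⟩
    sum (λ v → sum (λ e → ⌊ v ∈? S ⌋ ⊙ x v e))
      ≡⟨ ∑-comm (λ v e → ⌊ v ∈? S ⌋ ⊙ x v e) ⟩
    sum (λ e → sum (λ v → ⌊ v ∈? S ⌋ ⊙ x v e))
      ≡⟨ sum-cong-≗ (λ e → sum-incident e (c j e) (l e)) ⟩
    sum (λ e → (c j e ∧ cutEdges G S e) ⊙ l e) ∎
    where
    open ≡-Reasoning
    x : Fin n → Fin (m G) → BitString _
    x v e = (incident G v e ∧ c j e) ⊙ l e

  oneCutHit⇒Event : ∀ {b} (l : Fin (m G) → BitString b) c j →
                    (hits (c j) (cutEdges G S) ≡ᵇ 1) ≡ true → Event G l S c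
  oneCutHit⇒Event l c j oneHit
    with e , hit , sum≡lₑ ← sum-select-unique (λ e → c j e ∧ cutEdges G S e) l
                              (≡ᵇ⇒≡ _ 1 (Equivalence.from T-≡ oneHit))
    = j , e , toWitness (Equivalence.from T-≡ (∧-conicalʳ (c j e) _ hit)) , trans (H≡sum-cut l c j) sum≡lₑ

-- Sums over product spaces

record IsSummation {A : Set} (∑ : (A → ℕ) → ℕ) : Set where
  field
    ∑-cong : ∀ {f g : A → ℕ} → f ≗ g → ∑ f ≡ ∑ g
    ∑-*ˡ   : ∀ x (f : A → ℕ) → ∑ (λ a → x * f a) ≡ x * ∑ f
    ∑-mono : ∀ {f g : A → ℕ} → (∀ a → f a ≤ g a) → ∑ f ≤ ∑ g

  ∑-zero : ∑ (λ _ → 0) ≡ 0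
  ∑-zero = ∑-*ˡ 0 (λ _ → 0)

open IsSummation

sumBool-isSummation : IsSummation sumBool
sumBool-isSummation = record
  { ∑-cong = λ f≗g → cong₂ _+_ (f≗g true) (f≗g false)
  ; ∑-*ˡ   = λ x f → sym (*-distribˡ-+ x (f true) (f false))
  ; ∑-mono = λ f≤g → +-mono-≤ (f≤g true) (f≤g false)
  }

sumFun-isSummation : ∀ {A} {∑ : (A → ℕ) → ℕ} k → IsSummation ∑ → IsSummation (sumFun k ∑)
sumFun-isSummation zero    isΣ = record
  { ∑-cong = λ f≗g → f≗g _
  ; ∑-*ˡ   = λ _ _ → refl
  ; ∑-mono = λ f≤g → f≤g _
  }
sumFun-isSummation {∑ = ∑} (suc k) isΣ = record
  { ∑-cong = λ f≗g → ∑-cong isΣ (λ a → ∑-cong rest (λ f → f≗g _))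
  ; ∑-*ˡ   = λ x g → trans (∑-cong isΣ (λ a → ∑-*ˡ rest x _)) (∑-*ˡ isΣ x _)
  ; ∑-mono = λ f≤g → ∑-mono isΣ (λ a → ∑-mono rest (λ f → f≤g _))
  }
  where
  rest : IsSummation (sumFun k ∑)
  rest = sumFun-isSummation k isΣ

prodFin-cong : ∀ k {f g : Fin k → ℕ} → f ≗ g → prodFin k f ≡ prodFin k g
prodFin-cong zero    f≗g = refl
prodFin-cong (suc k) f≗g = cong₂ _*_ (f≗g zero) (prodFin-cong k (f≗g ∘ suc))

prodFin-mono : ∀ k {f g : Fin k → ℕ} → (∀ i → f i ≤ g i) → prodFin k f ≤ prodFin k g
prodFin-mono zero    f≤g = ≤-refl
prodFin-mono (suc k) f≤g = *-mono-≤ (f≤g zero) (prodFin-mono k (f≤g ∘ suc))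

prodFin-zero : ∀ {k} (f : Fin k → ℕ) j → f j ≡ 0 → prodFin k f ≡ 0
prodFin-zero {suc k} f zero    fⱼ≡0 = cong (_* prodFin k (f ∘ suc)) fⱼ≡0
prodFin-zero         f (suc j) fⱼ≡0 =
  trans (cong (f zero *_) (prodFin-zero (f ∘ suc) j fⱼ≡0)) (*-zeroʳ (f zero))

prodFin-const : ∀ k x → prodFin k (λ _ → x) ≡ x ^ k
prodFin-const zero    x = refl
prodFin-const (suc k) x = cong (x *_) (prodFin-const k x)

prodFin-update-≤ : ∀ {k} a (f g : Fin k → ℕ) j → (∀ i → i ≢ j → f i ≡ g i) → f j ≤ a * g j →
                   prodFin k f ≤ a * prodFin k g
prodFin-update-≤ a f g zero f≡g fⱼ≤a*gⱼ = begin
  f zero * prodFin _ (f ∘ suc)       ≡⟨ cong (f zero *_) (prodFin-cong _ (λ i → f≡g (suc i) (λ ()))) ⟩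
  f zero * prodFin _ (g ∘ suc)       ≤⟨ *-monoˡ-≤ _ fⱼ≤a*gⱼ ⟩
  a * g zero * prodFin _ (g ∘ suc)   ≡⟨ *-assoc a _ _ ⟩
  a * (g zero * prodFin _ (g ∘ suc)) ∎
  where open ≤-Reasoning
prodFin-update-≤ a f g (suc j) f≡g fⱼ≤a*gⱼ = begin
  f zero * prodFin _ (f ∘ suc)       ≤⟨ *-mono-≤ (≤-reflexive (f≡g zero (λ ()))) rest ⟩
  g zero * (a * prodFin _ (g ∘ suc)) ≡⟨ x∙yz≈y∙xz (g zero) a _ ⟩
  a * (g zero * prodFin _ (g ∘ suc)) ∎
  where
  open ≤-Reasoning
  rest : prodFin _ (f ∘ suc) ≤ a * prodFin _ (g ∘ suc)
  rest = prodFin-update-≤ a (f ∘ suc) (g ∘ suc) j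
           (λ i i≢j → f≡g (suc i) (i≢j ∘ Fin-suc-injective)) fⱼ≤a*gⱼ

module _ {A : Set} {∑ : (A → ℕ) → ℕ} (isΣ : IsSummation ∑) where

  sumFun-prodFin : ∀ k (g : Fin k → A → ℕ) →
                   sumFun k ∑ (λ f → prodFin k (λ i → g i (f i))) ≡ prodFin k (λ i → ∑ (g i))
  sumFun-prodFin zero    g = refl
  sumFun-prodFin (suc k) g = begin
    ∑ (λ a → sumFun k ∑ (λ f → g zero a * prodFin k (λ i → g (suc i) (f i))))
      ≡⟨ ∑-cong isΣ (λ a → ∑-*ˡ (sumFun-isSummation k isΣ) (g zero a) _) ⟩
    ∑ (λ a → g zero a * sumFun k ∑ (λ f → prodFin k (λ i → g (suc i) (f i))))
      ≡⟨ ∑-cong isΣ (λ a → cong (g zero a *_) (sumFun-prodFin k (g ∘ suc))) ⟩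
    ∑ (λ a → g zero a * rest)
      ≡⟨ ∑-cong isΣ (λ a → *-comm (g zero a) rest) ⟩
    ∑ (λ a → rest * g zero a)
      ≡⟨ ∑-*ˡ isΣ rest (g zero) ⟩
    rest * ∑ (g zero)
      ≡⟨ *-comm rest _ ⟩
    ∑ (g zero) * rest ∎
    where
    open ≡-Reasoning
    rest = prodFin k (λ i → ∑ (g (suc i)))

  module _ {b} (w : Fin b → A → ℕ) (j : Fin b) (E : A → Bool) where

    conditioned : Fin b → A → ℕ
    conditioned i r = if ⌊ i ≟ j ⌋ then (if E r then w i r else 0) else w i r

    conditioned-at : conditioned j ≗ λ r → if E r then w j r else 0
    conditioned-at r with j ≟ j
    ... | yes _   = refl
    ... | no  j≢j = contradiction refl j≢j

    conditioned-elsewhere : ∀ {i} → i ≢ j → conditioned i ≗ w i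
    conditioned-elsewhere {i} i≢j r with i ≟ j
    ... | yes i≡j = contradiction i≡j i≢j
    ... | no  _   = refl

    conditioned≤ : ∀ i r → conditioned i r ≤ w i r
    conditioned≤ i r with ⌊ i ≟ j ⌋ | E r
    ... | true  | true  = ≤-refl
    ... | true  | false = z≤n
    ... | false | _     = ≤-refl

    -- In probabilistic terms: if E on row j forces P, then Pr[E] ≥ 1/a implies Pr[P] ≥ 1/a.
    row-event-bound : ∀ {P : (Fin b → A) → Set} (P? : ∀ c → Dec (P c)) →
                      (∀ c → E (c j) ≡ true → P c) →
                      ∀ a → ∑ (w j) ≤ a * ∑ (λ r → if E r then w j r else 0) →
                      prodFin b (λ i → ∑ (w i))
                        ≤ a * sumFun b ∑ (λ c → if does (P? c) then prodFin b (λ i → w i (c i)) else 0)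
    row-event-bound P? E⇒P a Eⱼ-likely = begin
      prodFin b (λ i → ∑ (w i))
        ≤⟨ prodFin-update-≤ a _ _ j rows-agree rowⱼ ⟩
      a * prodFin b (λ i → ∑ (conditioned i))
        ≡⟨ cong (a *_) (sumFun-prodFin b conditioned) ⟨
      a * sumFun b ∑ (λ c → prodFin b (λ i → conditioned i (c i)))
        ≤⟨ *-monoʳ-≤ a (∑-mono (sumFun-isSummation b isΣ) pointwise) ⟩
      a * sumFun b ∑ (λ c → if does (P? c) then prodFin b (λ i → w i (c i)) else 0) ∎
      where
      open ≤-Reasoning
      rows-agree : ∀ i → i ≢ j → ∑ (w i) ≡ ∑ (conditioned i)
      rows-agree i i≢j = sym (∑-cong isΣ (conditioned-elsewhere i≢j))
      rowⱼ : ∑ (w j) ≤ a * ∑ (conditioned j)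
      rowⱼ = ≤-trans Eⱼ-likely (≤-reflexive (cong (a *_) (sym (∑-cong isΣ conditioned-at))))
      pointwise : ∀ c → prodFin b (λ i → conditioned i (c i))
                          ≤ (if does (P? c) then prodFin b (λ i → w i (c i)) else 0)
      pointwise c with P? c
      ... | yes _  = prodFin-mono b (λ i → conditioned≤ i (c i))
      ... | no ¬Pc = ≤-reflexive (prodFin-zero _ j (trans (conditioned-at (c j)) Eⱼ-fails))
        where
        Eⱼ-fails : (if E (c j) then w j (c j) else 0) ≡ 0
        Eⱼ-fails with E (c j) in Ecⱼ
        ... | true  = contradiction (E⇒P c Ecⱼ) ¬Pc
        ... | false = refl

rowSum : ∀ {M} → ((Fin M → Bool) → ℕ) → ℕ
rowSum {M} = sumFun M sumBool

rowSum-isSummation : ∀ {M} → IsSummation (rowSum {M})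
rowSum-isSummation {M} = sumFun-isSummation M sumBool-isSummation

-- rowWeight q r / (q + 1)^M is the probability of r when each edge is selected with probability
-- 1/(q + 1), independently.
rowWeight : ∀ {M} → ℕ → (Fin M → Bool) → ℕ
rowWeight {M} q r = prodFin M (λ e → if r e then 1 else q)

rowSum-rowWeight : ∀ {M} q → rowSum (rowWeight {M} q) ≡ suc q ^ M
rowSum-rowWeight {M} q = trans (sumFun-prodFin sumBool-isSummation M (λ _ a → if a then 1 else q))
                               (prodFin-const M (suc q))

hitMass : ∀ {M} → ℕ → (Fin M → Bool) → ℕ → ℕ
hitMass q cut j = rowSum (λ r → if hits r cut ≡ᵇ j then rowWeight q r else 0)

if-* : ∀ b x y → (if b then x * y else 0) ≡ x * (if b then y else 0)
if-* true  x y = refl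
if-* false x y = sym (*-zeroʳ x)

hitMass-∷ : ∀ {M} q c₀ (cut : Fin M → Bool) j →
  hitMass q (c₀ ∷ cut) j ≡ rowSum (λ r → if (if c₀ then suc (hits r cut) else hits r cut) ≡ᵇ j
                                                 then rowWeight q r else 0)
                           + q * hitMass q cut j
hitMass-∷ {M} q c₀ cut j = cong₂ _+_
  (∑-cong isΣ (λ r → trans (if-* (shifted r ≡ᵇ j) 1 (rowWeight q r)) (*-identityˡ _)))
  (trans (∑-cong isΣ (λ r → if-* (hits r cut ≡ᵇ j) q (rowWeight q r))) (∑-*ˡ isΣ q _))
  where
  isΣ : IsSummation (rowSum {M})
  isΣ = rowSum-isSummation {M}
  shifted : (Fin M → Bool) → ℕ
  shifted r = if c₀ then suc (hits r cut) else hits r cut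

hitMass-true-0 : ∀ {M} q (cut : Fin M → Bool) → hitMass q (true ∷ cut) 0 ≡ q * hitMass q cut 0
hitMass-true-0 {M} q cut =
  trans (hitMass-∷ q true cut 0) (cong (_+ q * hitMass q cut 0) (∑-zero (rowSum-isSummation {M})))

-- Below, hitMass-zero-∷ (cut zero) (cut ∘ suc) is about cut zero ∷ cut ∘ suc rather than cut; the
-- types agree by computation because cut is only ever applied to zero or to suc i.
hitMass-zero : ∀ {M} q (cut : Fin M → Bool) → hitMass q cut 0 ≡ q ^ count cut * suc q ^ count (not ∘ cut)
hitMass-zero {zero}  q cut = refl
hitMass-zero {suc M} q cut = hitMass-zero-∷ (cut zero) (cut ∘ suc)
  where
  hitMass-zero-∷ : ∀ c₀ cut' →
                   hitMass q (c₀ ∷ cut') 0 ≡ q ^ count (c₀ ∷ cut') * suc q ^ count (not ∘ (c₀ ∷ cut'))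
  hitMass-zero-∷ true cut' = begin
    hitMass q (true ∷ cut') 0        ≡⟨ hitMass-true-0 q cut' ⟩
    q * hitMass q cut' 0             ≡⟨ cong (q *_) (hitMass-zero q cut') ⟩
    q * (q ^ K * suc q ^ L)          ≡⟨ *-assoc q _ _ ⟨
    q * q ^ K * suc q ^ L            ∎
    where
    open ≡-Reasoning
    K = count cut'
    L = count (not ∘ cut')
  hitMass-zero-∷ false cut' = begin
    hitMass q (false ∷ cut') 0       ≡⟨ hitMass-∷ q false cut' 0 ⟩
    suc q * hitMass q cut' 0         ≡⟨ cong (suc q *_) (hitMass-zero q cut') ⟩
    suc q * (q ^ K * suc q ^ L)      ≡⟨ x∙yz≈y∙xz (suc q) (q ^ K) _ ⟩
    q ^ K * (suc q * suc q ^ L)      ∎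
    where
    open ≡-Reasoning
    K = count cut'
    L = count (not ∘ cut')

hitMass-one : ∀ {M} q (cut : Fin M → Bool) → q * hitMass q cut 1 ≡ count cut * hitMass q cut 0
hitMass-one {zero}  q cut = *-zeroʳ q
hitMass-one {suc M} q cut = hitMass-one-∷ (cut zero) (cut ∘ suc)
  where
  hitMass-one-∷ : ∀ c₀ cut' → q * hitMass q (c₀ ∷ cut') 1 ≡ count (c₀ ∷ cut') * hitMass q (c₀ ∷ cut') 0
  hitMass-one-∷ true cut' = begin
    q * hitMass q (true ∷ cut') 1    ≡⟨ cong (q *_) (hitMass-∷ q true cut' 1) ⟩
    q * (H₀ + q * H₁)                ≡⟨ *-distribˡ-+ q H₀ (q * H₁) ⟩
    q * H₀ + q * (q * H₁)            ≡⟨ cong (λ x → q * H₀ + q * x) (hitMass-one q cut') ⟩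
    q * H₀ + q * (K * H₀)            ≡⟨ rearrange q H₀ K ⟩
    suc K * (q * H₀)                 ≡⟨ cong (suc K *_) (hitMass-true-0 q cut') ⟨
    suc K * hitMass q (true ∷ cut') 0 ∎
    where
    open ≡-Reasoning
    K = count cut'
    H₀ = hitMass q cut' 0
    H₁ = hitMass q cut' 1
    rearrange : ∀ x y z → x * y + x * (z * y) ≡ suc z * (x * y)
    rearrange = solve-∀
  hitMass-one-∷ false cut' = begin
    q * hitMass q (false ∷ cut') 1   ≡⟨ cong (q *_) (hitMass-∷ q false cut' 1) ⟩
    q * (suc q * H₁)                 ≡⟨ x∙yz≈y∙xz q (suc q) H₁ ⟩
    suc q * (q * H₁)                 ≡⟨ cong (suc q *_) (hitMass-one q cut') ⟩
    suc q * (K * H₀)                 ≡⟨ x∙yz≈y∙xz (suc q) K H₀ ⟩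
    K * (suc q * H₀)                 ≡⟨ cong (K *_) (hitMass-∷ q false cut' 0) ⟨
    K * hitMass q (false ∷ cut') 0   ∎
    where
    open ≡-Reasoning
    K = count cut'
    H₀ = hitMass q cut' 0
    H₁ = hitMass q cut' 1

rowSum≤9*hitMass-one : ∀ {M} q .{{_ : NonZero q}} (cut : Fin M → Bool) → ExactlyOneLikely q (count cut) →
                       rowSum (rowWeight {M} q) ≤ 9 * hitMass q cut 1
rowSum≤9*hitMass-one {M} q cut likely = *-cancelˡ-≤ q (begin
  q * rowSum (rowWeight {M} q)     ≡⟨ cong (q *_) (rowSum-rowWeight {M} q) ⟩
  q * suc q ^ M                    ≡⟨ cong (λ k → q * suc q ^ k) (count+count-not cut) ⟨
  q * suc q ^ (K + L)              ≡⟨ cong (q *_) (^-distribˡ-+-* (suc q) K L) ⟩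
  q * (suc q ^ K * suc q ^ L)      ≡⟨ *-assoc q _ _ ⟨
  q * suc q ^ K * suc q ^ L        ≤⟨ *-monoˡ-≤ (suc q ^ L) likely ⟩
  9 * (K * q ^ K) * suc q ^ L      ≡⟨ rearrange K (q ^ K) (suc q ^ L) ⟩
  9 * (K * (q ^ K * suc q ^ L))    ≡⟨ cong (λ x → 9 * (K * x)) (hitMass-zero q cut) ⟨
  9 * (K * hitMass q cut 0)        ≡⟨ cong (9 *_) (hitMass-one q cut) ⟨
  9 * (q * hitMass q cut 1)        ≡⟨ x∙yz≈y∙xz 9 q _ ⟩
  q * (9 * hitMass q cut 1)        ∎)
  where
  open ≤-Reasoning
  K = count cut
  L = count (not ∘ cut)
  rearrange : ∀ a b c → 9 * (a * b) * c ≡ 9 * (a * (b * c))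
  rearrange = solve-∀

denom≡∏rowSum : ∀ b M → denom b M ≡ prodFin b (λ i → rowSum (rowWeight {M} (oddsAgainst i)))
denom≡∏rowSum b M = prodFin-cong b λ i → begin
  prodFin M (λ _ → 2 ^ suc (toℕ i))     ≡⟨ prodFin-const M _ ⟩
  (2 ^ suc (toℕ i)) ^ M                  ≡⟨ cong (_^ M) (suc-odds i) ⟨
  suc (oddsAgainst i) ^ M                ≡⟨ rowSum-rowWeight {M} (oddsAgainst i) ⟨
  rowSum (rowWeight {M} (oddsAgainst i)) ∎
  where
  open ≡-Reasoning
  suc-odds : ∀ {b} (i : Fin b) → suc (oddsAgainst i) ≡ 2 ^ suc (toℕ i)
  suc-odds i = trans (cong suc (sym (mersenne≡2^t∸1 (suc (toℕ i))))) (suc-mersenne (suc (toℕ i)))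

combine-punchOut-injective : ∀ {n} {u w u' w' : Fin (suc n)} (u≢w : u ≢ w) (u'≢w' : u' ≢ w') →
                             combine u (punchOut u≢w) ≡ combine u' (punchOut u'≢w') → (u , w) ≡ (u' , w')
combine-punchOut-injective {u = u} {u' = u'} u≢w u'≢w' code≡
  with refl , punchOut≡ ← combine-injective u (punchOut u≢w) u' (punchOut u'≢w') code≡ =
  cong (u ,_) (punchOut-injective u≢w u'≢w' punchOut≡)

edges<n*n : ∀ {n} → 1 ≤ n → (G : SimpleGraph n) → m G < n * n
edges<n*n {suc n} _ G = ≤-<-trans (injective⇒≤ code-injective) (*-monoʳ-< (suc n) (n<1+n n))
  where
  code : Fin (m G) → Fin (suc n * n)
  code e = combine (proj₁ (ends G e)) (punchOut (noLoop G e))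
  code-injective : ∀ {e e'} → code e ≡ code e' → e ≡ e'
  code-injective {e} {e'} code≡ =
    noMulti G e e' (inj₁ (combine-punchOut-injective (noLoop G e) (noLoop G e') code≡))

corollaryB6 : (n : ℕ) → 2 ≤ n → (G : SimpleGraph n) →
    (l : Fin (m G) → BitString (β n)) →
    (∀ e → 1 ≤ bitsVal (l e) × bitsVal (l e) ≤ (n * (n ∸ 1)) / 2) →
    (S : Subset n) → Σ (Fin (m G)) (InCut G S) →
    denom (β n) (m G) ≤ 9 * probNum (event? G l S)
corollaryB6 n n≥2 G l _ S (e , e∈cut) = begin
  denom (β n) (m G)                   ≡⟨ denom≡∏rowSum (β n) (m G) ⟩
  prodFin (β n) (λ i → rowSum (w i))  ≤⟨ row-event-bound rowSum-isSummation w j oneCutHit (event? G l S)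
                                           (λ c → oneCutHit⇒Event G S l c j) 9 rowⱼ-bound ⟩
  9 * probNum (event? G l S)          ∎
  where
  open ≤-Reasoning
  cut : Fin (m G) → Bool
  cut = cutEdges G S
  w : Fin (β n) → (Fin (m G) → Bool) → ℕ
  w i = rowWeight (oddsAgainst i)
  oneCutHit : (Fin (m G) → Bool) → Bool
  oneCutHit r = hits r cut ≡ᵇ 1
  K≥1 : 1 ≤ count cut
  K≥1 = count-pos cut e (Equivalence.to T-≡ (fromWitness e∈cut))
  K<n*n : count cut < n * n
  K<n*n = ≤-<-trans (count≤ cut) (edges<n*n (≤-trans (s≤s z≤n) n≥2) G)
  level : ∃[ j ] ExactlyOneLikely (oddsAgainst j) (count cut)
  level = exactlyOneLikely-level<β n≥2 K≥1 K<n*n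
  j : Fin (β n)
  j = proj₁ level
  rowⱼ-bound : rowSum (w j) ≤ 9 * hitMass (oddsAgainst j) cut 1
  rowⱼ-bound = rowSum≤9*hitMass-one (oddsAgainst j) {{oddsAgainst-nonZero j}} cut (proj₂ level)
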